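{- Let $k$ be a positive integer. If there exists an RSD set of integers of cardinality $k$, then for every integer $n \geq k$ there exist infinitely many RSD sets of integers of cardinality $k^n + 1$; that is, $H^*(k^n + 1) = \infty$ for all integers $n \geq k$.
   Context: For a nonempty finite set $A \subseteq \mathbb{Z}$, define $A - A := \{a - b : a, b \in A\}$ and the restricted sumset $A \dotplus A := \{a + b : a, b \in A,\ a \neq b\}$. The set $A$ is called a restricted-sum-dominant (RSD) set if $|A \dotplus A| > |A - A|$. For an integer $c$ and a set $A$, let $c + A := \{c + a : a \in A\}$ and $c \cdot A := \{ca : a \in A\}$. Two finite sets $A, B \subseteq \mathbb{Z}$ are affinely equivalent if there exist integers $x$ and $r \neq 0$ such that $A = x + r \cdot B$ or $B = x + r \cdot A$; otherwise they are affinely inequivalent. For a positive integer $k$, $H^*(k)$ denotes the number (possibly infinite) of pairwise affinely inequivalent RSD sets of integers of cardinality $k$. -}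

module Defs where

open import Data.Integer using (ℤ; _+_; _-_; _*_; 0ℤ; _≟_)
open import Data.Nat using (ℕ; _<_; _^_) renaming (_+_ to _+ℕ_)
open import Data.List using (List; length; deduplicate; map; concatMap; filter)
open import Data.List.Membership.Propositional using (_∈_)
open import Data.List.Relation.Unary.Unique.Propositional using (Unique)
open import Data.Product using (Σ; _×_; _,_; ∃; ∃-syntax)
open import Data.Sum using (_⊎_)
open import Relation.Nullary using (¬_; ¬?)
open import Relation.Binary.PropositionalEquality using (_≡_; _≢_)
open import Function.Bundles using (_⇔_)

-- A finite set of integers is represented by a list; its underlying set is
-- the set of list members. Cardinality of the underlying set = number of
-- distinct entries.
card : List ℤ → ℕ
card xs = length (deduplicate _≟_ xs)

diffSet : List ℤ → List ℤ
diffSet A = concatMap (λ a → map (λ b → a - b) A) A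

restrSumSet : List ℤ → List ℤ
restrSumSet A =
  concatMap (λ a → map (λ b → a + b) (filter (λ b → ¬? (a ≟ b)) A)) A

RSD : List ℤ → Set
RSD A = card (diffSet A) < card (restrSumSet A)

_≈ₛ_ : List ℤ → List ℤ → Set
A ≈ₛ B = ∀ z → (z ∈ A) ⇔ (z ∈ B)

affImage : ℤ → ℤ → List ℤ → List ℤ
affImage x r B = map (λ b → x + r * b) B

AffEquiv : List ℤ → List ℤ → Set
AffEquiv A B =
  ∃[ x ] ∃[ r ] (r ≢ 0ℤ × (A ≈ₛ affImage x r B ⊎ B ≈ₛ affImage x r A))

-- H*(m) = ∞ : there is an infinite family (indexed by ℕ) of RSD sets of
-- cardinality m that are pairwise affinely inequivalent.
HStarInfinite : ℕ → Set
HStarInfinite m =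
  Σ (ℕ → List ℤ) λ F →
    (∀ i → card (F i) ≡ m × RSD (F i))
    × (∀ i j → i ≢ j → ¬ AffEquiv (F i) (F j))

module Submission where

-- Write n = m + 1 and q = k^m.  For a large integer t put
--     S_t = { a + t·j : a ∈ A, 0 ≤ j < q }  ∪  { a₀ + t·q },
-- a set of q·k + 1 = k^n + 1 integers (a₀ ∈ A is fixed).  Once t exceeds twice
-- the size of the elements of A ∔ A and A - A, an integer u + t·m with small u
-- has a unique "digit" u and "level" m.  Hence
--     S_t - S_t ⊆ (A - A) + t·[-q, q]                 (2q + 1)·|A - A| elements,
--     S_t ∔ S_t ⊇ (A ∔ A) + t·[0, 2q - 1) ∪ (a₀ + A) + t·(2q - 1),
-- and the latter has (2q - 1)·|A ∔ A| + k elements.  Since |A - A| < |A ∔ A|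
-- and |A ∔ A| ≤ k(k-1) ≤ k^m = q, the set S_t is again RSD.
-- Affine inequivalence is measured by two invariants: S_t has diameter at most
-- K + t·q and contains two points at distance exactly t·q and two distinct
-- points at distance at most K (K depends only on A).  An affine equivalence
-- between S and T bounds the span of T by K times the diameter of S, so a
-- sequence of scales t_0 < t_1 < ... growing fast enough gives infinitely many
-- pairwise inequivalent RSD sets of cardinality k^n + 1.

open import Defs

module Development where

  open import Data.Nat as ℕ
    using (ℕ; zero; suc; z≤n; s≤s; _≤_; _<_; _∸_; _^_)
    renaming (_+_ to _+ℕ_; _*_ to _*ℕ_)
  open import Data.Nat.Properties as ℕₚ
    using (≤-refl; ≤-trans; <-≤-trans; ≤-<-trans; <-irrefl; m≤m+n; m≤n+m;
           +-mono-≤; *-mono-≤; *-monoʳ-≤; *-monoˡ-≤)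
  import Data.Nat.Tactic.RingSolver as ℕRing
  open import Data.Integer
    using (ℤ; +_; -[1+_]; _+_; _-_; _*_; ∣_∣; _≟_; 0ℤ)
  open import Data.Integer.Properties
    using (abs-*; pos-+; +-injective; ∣i∣≡0⇒i≡0; i-j≡0⇒i≡j; ∣i+j∣≤∣i∣+∣j∣; ∣i-j∣≤∣i∣+∣j∣;
           m-n≡m⊖n; ∣m⊝n∣≤m⊔n; +-inverseʳ; +-identityʳ)
  open import Data.Integer.Tactic.RingSolver using (solve-∀)
  open import Data.List
    using (List; []; _∷_; [_]; _++_; length; map; concatMap; filter; deduplicate; upTo)
  open import Data.List.Properties using (length-++; length-map; length-filter; length-upTo)
  open import Data.List.Membership.Propositional using (_∈_; find; lose)
  open import Data.List.Membership.Propositional.Properties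
    using (∈-map⁺; ∈-map⁻; ∈-++⁺ˡ; ∈-++⁺ʳ; ∈-++⁻; ∈-concatMap⁺; ∈-concatMap⁻; ∈-filter⁺; ∈-filter⁻;
           ∈-deduplicate⁺; ∈-deduplicate⁻; ∈-applyUpTo⁺; ∈-applyUpTo⁻)
  open import Data.List.Relation.Binary.Subset.Propositional using (_⊆_)
  open import Data.List.Relation.Unary.Any using (here; there)
  open import Data.List.Relation.Unary.Unique.Propositional using (Unique; []; _∷_)
  open import Data.List.Relation.Unary.Unique.Propositional.Properties using (++⁺; map⁺; upTo⁺)
  open import Data.List.Relation.Unary.Unique.DecPropositional.Properties using (deduplicate-!)
  open import Data.Product using (_×_; _,_; ∃-syntax; proj₁; proj₂)
  open import Data.Sum using (inj₁; inj₂)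
  open import Data.Empty using (⊥-elim)
  open import Function using (id)
  open import Function.Bundles using (Equivalence)
  open import Relation.Nullary using (¬_; yes; no; ¬?)
  open import Relation.Binary.Definitions using (tri<; tri≈; tri>)
  open import Relation.Binary.PropositionalEquality
    using (_≡_; _≢_; refl; sym; trans; cong; cong₂; subst; module ≡-Reasoning)
  open import Data.List.Relation.Unary.All as All using ()

  -- Pigeonhole: a repetition-free list contained in ys is no longer than ys.
  -- (One occurrence of each element of xs is removed from ys in turn.)
  module _ {X : Set} where

    private
      remove : ∀ {x : X} (ys : List X) → x ∈ ys → List X
      remove (y ∷ ys) (here _)  = ys
      remove (y ∷ ys) (there p) = y ∷ remove ys p

      length-remove : ∀ {x : X} (ys : List X) (p : x ∈ ys) → suc (length (remove ys p)) ≡ length ys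
      length-remove (y ∷ ys) (here _)  = refl
      length-remove (y ∷ ys) (there p) = cong suc (length-remove ys p)

      ∈-remove : ∀ {x z : X} (ys : List X) (p : x ∈ ys) → z ∈ ys → z ≢ x → z ∈ remove ys p
      ∈-remove (y ∷ ys) (here refl) (here refl) z≢x = ⊥-elim (z≢x refl)
      ∈-remove (y ∷ ys) (here refl) (there z∈)  _   = z∈
      ∈-remove (y ∷ ys) (there p)   (here z≡y)  _   = here z≡y
      ∈-remove (y ∷ ys) (there p)   (there z∈)  z≢x = there (∈-remove ys p z∈ z≢x)

    unique-length-≤ : ∀ {xs ys : List X} → Unique xs → xs ⊆ ys → length xs ≤ length ys
    unique-length-≤ {[]}     _          _   = z≤n
    unique-length-≤ {x ∷ xs} {ys} (x∉xs ∷ u) xs⊆ys =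
      subst (suc (length xs) ≤_) (length-remove ys x∈ys) (s≤s (unique-length-≤ u xs⊆rest))
      where
      x∈ys : x ∈ ys
      x∈ys = xs⊆ys (here refl)
      xs⊆rest : xs ⊆ remove ys x∈ys
      xs⊆rest z∈ = ∈-remove ys x∈ys (xs⊆ys (there z∈)) (λ z≡x → All.lookup x∉xs z∈ (sym z≡x))

  card-≥ : ∀ {U L : List ℤ} → Unique U → U ⊆ L → length U ≤ card L
  card-≥ u U⊆L = unique-length-≤ u (λ y∈ → ∈-deduplicate⁺ _≟_ (U⊆L y∈))

  card-≤ : ∀ {L C : List ℤ} → L ⊆ C → card L ≤ length C
  card-≤ {L} L⊆C = unique-length-≤ (deduplicate-! _≟_ L) (λ y∈ → L⊆C (∈-deduplicate⁻ _≟_ L y∈))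

  card-unique : ∀ {L : List ℤ} → Unique L → card L ≡ length L
  card-unique {L} u = ℕₚ.≤-antisym (card-≤ {L} id) (card-≥ {L} u id)

  module _ {I X : Set} (f : I → List X) where

    concatMap-unique : ∀ {is} → Unique is → (∀ i → Unique (f i))
                     → (∀ {i j y} → y ∈ f i → y ∈ f j → i ≡ j) → Unique (concatMap f is)
    concatMap-unique {[]}     []         _  _        = []
    concatMap-unique {i ∷ is} (i∉is ∷ u) uf disjoint =
      ++⁺ (uf i) (concatMap-unique u uf disjoint) separate
      where
      separate : ∀ {y} → ¬ (y ∈ f i × y ∈ concatMap f is)
      separate (y∈fi , y∈rest) with find (∈-concatMap⁻ f y∈rest)
      ... | j , j∈ , y∈fj = All.lookup i∉is j∈ (disjoint y∈fi y∈fj)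

    length-concatMap : ∀ c is → (∀ i → length (f i) ≡ c) → length (concatMap f is) ≡ length is *ℕ c
    length-concatMap c []       _ = refl
    length-concatMap c (i ∷ is) h =
      trans (length-++ (f i)) (cong₂ _+ℕ_ (h i) (length-concatMap c is h))

    length-concatMap-≤ : ∀ c is → (∀ {i} → i ∈ is → length (f i) ≤ c) → length (concatMap f is) ≤ length is *ℕ c
    length-concatMap-≤ c []       _ = z≤n
    length-concatMap-≤ c (i ∷ is) h =
      subst (_≤ c +ℕ length is *ℕ c) (sym (length-++ (f i)))
        (+-mono-≤ (h (here refl)) (length-concatMap-≤ c is (λ p → h (there p))))

  ∈-upTo⁺ : ∀ {j n} → j < n → j ∈ upTo n
  ∈-upTo⁺ = ∈-applyUpTo⁺ id

  ∈-upTo⁻ : ∀ {j n} → j ∈ upTo n → j < n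
  ∈-upTo⁻ j∈ with ∈-applyUpTo⁻ id j∈
  ... | _ , j<n , refl = j<n

  diffSet⁻ : ∀ {A y} → y ∈ diffSet A → ∃[ a ] ∃[ b ] (a ∈ A × b ∈ A × y ≡ a - b)
  diffSet⁻ {A} y∈ with find (∈-concatMap⁻ (λ a → map (a -_) A) y∈)
  ... | a , a∈ , y∈' with ∈-map⁻ (a -_) y∈'
  ... | b , b∈ , y≡ = a , b , a∈ , b∈ , y≡

  diffSet⁺ : ∀ {A a b} → a ∈ A → b ∈ A → a - b ∈ diffSet A
  diffSet⁺ {A} {a} a∈ b∈ = ∈-concatMap⁺ (λ a → map (a -_) A) (lose a∈ (∈-map⁺ (a -_) b∈))

  others : ℤ → List ℤ → List ℤ
  others a A = filter (λ b → ¬? (a ≟ b)) A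

  restrSumSet⁻ : ∀ {A y} → y ∈ restrSumSet A → ∃[ a ] ∃[ b ] (a ∈ A × b ∈ A × a ≢ b × y ≡ a + b)
  restrSumSet⁻ {A} y∈ with find (∈-concatMap⁻ (λ a → map (λ b → a + b) (others a A)) y∈)
  ... | a , a∈ , y∈' with ∈-map⁻ (λ b → a + b) y∈'
  ... | b , b∈' , y≡ with ∈-filter⁻ (λ b → ¬? (a ≟ b)) b∈'
  ... | b∈ , a≢b = a , b , a∈ , b∈ , a≢b , y≡

  restrSumSet⁺ : ∀ {A a b} → a ∈ A → b ∈ A → a ≢ b → a + b ∈ restrSumSet A
  restrSumSet⁺ {A} {a} a∈ b∈ a≢b = ∈-concatMap⁺ (λ a → map (λ b → a + b) (others a A))
    (lose a∈ (∈-map⁺ (λ b → a + b) (∈-filter⁺ (λ b → ¬? (a ≟ b)) b∈ a≢b)))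

  distinct-pair : ∀ {A} → 0 < card (restrSumSet A) → ∃[ a ] ∃[ b ] (a ∈ A × b ∈ A × a ≢ b)
  distinct-pair {A} nonempty with deduplicate _≟_ (restrSumSet A) | ∈-deduplicate⁻ _≟_ (restrSumSet A)
  ... | y ∷ _ | from-dedup with restrSumSet⁻ {A} (from-dedup (here refl))
  ... | a , b , a∈ , b∈ , a≢b , _ = a , b , a∈ , b∈ , a≢b

  -- |A ∔ A| ≤ |A|(|A| - 1): each of the |A| distinct summands a pairs with at
  -- most |A| - 1 others.
  card-restrSumSet : ∀ A → card (restrSumSet A) ≤ card A *ℕ (card A ∸ 1)
  card-restrSumSet A =
    ≤-trans (card-≤ {restrSumSet A} same-sums)
            (length-concatMap-≤ (λ a → map (λ b → a + b) (others a X)) (card A ∸ 1) X row-length)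
    where
    X : List ℤ
    X = deduplicate _≟_ A
    others-shorter : ∀ {a} (xs : List ℤ) → a ∈ xs → suc (length (others a xs)) ≤ length xs
    others-shorter {a} (x ∷ xs) (here refl) with a ≟ a
    ... | yes _   = s≤s (length-filter (λ b → ¬? (a ≟ b)) xs)
    ... | no a≢a = ⊥-elim (a≢a refl)
    others-shorter {a} (x ∷ xs) (there a∈) with a ≟ x
    ... | yes _ = ℕₚ.m≤n⇒m≤1+n (others-shorter xs a∈)
    ... | no _  = s≤s (others-shorter xs a∈)
    row-length : ∀ {a} → a ∈ X → length (map (λ b → a + b) (others a X)) ≤ card A ∸ 1
    row-length {a} a∈ rewrite length-map (λ b → a + b) (others a X) = ℕₚ.∸-monoˡ-≤ 1 (others-shorter X a∈)
    same-sums : restrSumSet A ⊆ restrSumSet X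
    same-sums y∈ with restrSumSet⁻ {A} y∈
    ... | a , b , a∈ , b∈ , a≢b , refl =
      restrSumSet⁺ (∈-deduplicate⁺ _≟_ a∈) (∈-deduplicate⁺ _≟_ b∈) a≢b

  absBound : List ℤ → ℕ
  absBound []      = 0
  absBound (a ∷ A) = ∣ a ∣ +ℕ absBound A

  width : List ℤ → ℕ
  width A = absBound A +ℕ absBound A

  absBound-∈ : ∀ {A a} → a ∈ A → ∣ a ∣ ≤ absBound A
  absBound-∈ {_ ∷ A} (here refl) = m≤m+n _ (absBound A)
  absBound-∈ {x ∷ _} (there a∈)  = ≤-trans (absBound-∈ a∈) (m≤n+m _ ∣ x ∣)

  elem-bound : ∀ {A a} → a ∈ A → ∣ a ∣ ≤ width A
  elem-bound {A} a∈ = ≤-trans (absBound-∈ a∈) (m≤m+n _ (absBound A))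

  sum-bound : ∀ {A a b} → a ∈ A → b ∈ A → ∣ a + b ∣ ≤ width A
  sum-bound {a = a} {b} a∈ b∈ = ≤-trans (∣i+j∣≤∣i∣+∣j∣ a b) (+-mono-≤ (absBound-∈ a∈) (absBound-∈ b∈))

  diff-bound : ∀ {A a b} → a ∈ A → b ∈ A → ∣ a - b ∣ ≤ width A
  diff-bound {a = a} {b} a∈ b∈ = ≤-trans (∣i-j∣≤∣i∣+∣j∣ a b) (+-mono-≤ (absBound-∈ a∈) (absBound-∈ b∈))

  +-cancelʳ : ∀ c {x y : ℤ} → x + c ≡ y + c → x ≡ y
  +-cancelʳ c {x} {y} e = trans (undo x c) (trans (cong (_- c) e) (sym (undo y c)))
    where
    undo : ∀ z c → z ≡ (z + c) - c
    undo = solve-∀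

  +-cancelˡ : ∀ c {x y : ℤ} → c + x ≡ c + y → x ≡ y
  +-cancelˡ c {x} {y} e = +-cancelʳ c (trans (swap x c) (trans e (swap c y)))
    where
    swap : ∀ z c → z + c ≡ c + z
    swap = solve-∀

  nonzero-abs : ∀ {r} → r ≢ 0ℤ → 1 ≤ ∣ r ∣
  nonzero-abs {r} r≢0 with ∣ r ∣ in eq
  ... | zero  = ⊥-elim (r≢0 (∣i∣≡0⇒i≡0 eq))
  ... | suc _ = s≤s z≤n

  distinct-distance : ∀ {u v} → u ≢ v → 1 ≤ ∣ u - v ∣
  distinct-distance {u} {v} u≢v = nonzero-abs (λ e → u≢v (i-j≡0⇒i≡j u v e))

  ≤-scaled : ∀ {a} b → 1 ≤ a → b ≤ a *ℕ b
  ≤-scaled {a} b 1≤a = subst (_≤ a *ℕ b) (ℕₚ.*-identityˡ b) (*-monoˡ-≤ b 1≤a)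

  multiple-below : ∀ t w → t *ℕ ∣ w ∣ < t → w ≡ 0ℤ
  multiple-below t w small with ∣ w ∣ in eq
  ... | zero  = ∣i∣≡0⇒i≡0 eq
  ... | suc d = ⊥-elim (<-irrefl refl (≤-<-trans (ℕₚ.m≤m*n t (suc d)) small))

  -- Base-t digits: if |v - u| < t then u + t·m = v + t·m' forces m = m' and
  -- u = v (the difference t·(m - m') would be a nonzero multiple of t below t).
  block-injective : ∀ t {u v m m'} → ∣ v - u ∣ < t → u + + t * m ≡ v + + t * m' → m ≡ m' × u ≡ v
  block-injective t {u} {v} {m} {m'} gap e =
    m≡m' , +-cancelʳ (+ t * m) (trans e (cong (λ z → v + + t * z) (sym m≡m')))
    where
    open ≡-Reasoning
    regroup : ∀ u v T m m' → v - u ≡ T * (m - m') + ((v + T * m') - (u + T * m))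
    regroup = solve-∀
    T : ℤ
    T = + t
    v-u≡t[m-m'] : v - u ≡ T * (m - m')
    v-u≡t[m-m'] = begin
      v - u                                         ≡⟨ regroup u v T m m' ⟩
      T * (m - m') + ((v + T * m') - (u + T * m))   ≡⟨ cong (λ z → T * (m - m') + ((v + T * m') - z)) e ⟩
      T * (m - m') + ((v + T * m') - (v + T * m'))  ≡⟨ cong (λ z → T * (m - m') + z) (+-inverseʳ (v + T * m')) ⟩
      T * (m - m') + 0ℤ                             ≡⟨ +-identityʳ _ ⟩
      T * (m - m')                                  ∎
    small-multiple : t *ℕ ∣ m - m' ∣ < t
    small-multiple = subst (_< t) (trans (cong ∣_∣ v-u≡t[m-m']) (abs-* T (m - m'))) gap
    m≡m' : m ≡ m'
    m≡m' = i-j≡0⇒i≡j m m' (multiple-below t (m - m') small-multiple)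

  symRange : ℕ → List ℤ
  symRange q = map +_ (upTo (suc q)) ++ map -[1+_] (upTo q)

  length-symRange : ∀ q → length (symRange q) ≡ suc q +ℕ q
  length-symRange q = trans (length-++ (map +_ (upTo (suc q))))
    (cong₂ _+ℕ_ (trans (length-map +_ (upTo (suc q))) (length-upTo (suc q)))
                (trans (length-map -[1+_] (upTo q)) (length-upTo q)))

  ∈-symRange : ∀ q {w} → ∣ w ∣ ≤ q → w ∈ symRange q
  ∈-symRange q {+ n}      n≤q = ∈-++⁺ˡ (∈-map⁺ +_ (∈-upTo⁺ (s≤s n≤q)))
  ∈-symRange q { -[1+ n ]} n<q = ∈-++⁺ʳ (map +_ (upTo (suc q))) (∈-map⁺ -[1+_] (∈-upTo⁺ n<q))

  distance-≤ : ∀ {q j j'} → j ≤ q → j' ≤ q → ∣ + j - + j' ∣ ≤ q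
  distance-≤ {q} {j} {j'} j≤q j'≤q =
    subst (_≤ q) (sym (cong ∣_∣ (m-n≡m⊖n j j'))) (≤-trans (∣m⊝n∣≤m⊔n j j') (ℕₚ.⊔-lub j≤q j'≤q))

  -- The counting inequality behind the RSD property of the construction:
  -- if d < r ≤ q = p + 1 then (2q + 1)·d < (2q - 1)·r (+ k).
  rsd-inequality : ∀ p d r k → d < r → r ≤ suc p
                 → (suc (suc p) +ℕ suc p) *ℕ d < (suc p +ℕ p) *ℕ r +ℕ k
  rsd-inequality p d r k d<r r≤q = begin-strict
      (suc (suc p) +ℕ suc p) *ℕ d       ≡⟨ expand p d ⟩
      (suc p +ℕ p) *ℕ d +ℕ (d +ℕ d)     <⟨ ℕₚ.+-monoʳ-< ((suc p +ℕ p) *ℕ d) (s≤s (+-mono-≤ d≤p d≤p)) ⟩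
      (suc p +ℕ p) *ℕ d +ℕ (suc p +ℕ p) ≡⟨ collect p d ⟩
      (suc p +ℕ p) *ℕ suc d             ≤⟨ *-monoʳ-≤ (suc p +ℕ p) d<r ⟩
      (suc p +ℕ p) *ℕ r                 ≤⟨ m≤m+n _ k ⟩
      (suc p +ℕ p) *ℕ r +ℕ k            ∎
    where
    open ℕₚ.≤-Reasoning
    d≤p : d ≤ p
    d≤p = ℕₚ.≤-pred (≤-trans d<r r≤q)
    expand : ∀ p d → (suc (suc p) +ℕ suc p) *ℕ d ≡ (suc p +ℕ p) *ℕ d +ℕ (d +ℕ d)
    expand = ℕRing.solve-∀
    collect : ∀ p d → (suc p +ℕ p) *ℕ d +ℕ (suc p +ℕ p) ≡ (suc p +ℕ p) *ℕ suc d
    collect = ℕRing.solve-∀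

  <-^ : ∀ b i → 2 ≤ b → i < b ^ i
  <-^ b zero    _   = s≤s z≤n
  <-^ b (suc i) 2≤b = begin-strict
      suc i             <⟨ s≤s (m≤m+n (suc i) i) ⟩
      suc (suc i +ℕ i)  ≡⟨ double i ⟩
      2 *ℕ suc i        ≤⟨ *-mono-≤ 2≤b (<-^ b i 2≤b) ⟩
      b *ℕ b ^ i        ∎
    where
    open ℕₚ.≤-Reasoning
    double : ∀ i → suc (suc i +ℕ i) ≡ 2 *ℕ suc i
    double = ℕRing.solve-∀

  -- k(k - 1) ≤ k^m whenever k ≤ m + 1; this makes |A ∔ A| ≤ k^m.
  pairs-≤-power : ∀ k m → k ≤ suc m → k *ℕ (k ∸ 1) ≤ k ^ m
  pairs-≤-power zero          m _         = z≤n
  pairs-≤-power (suc zero)    m _         = z≤n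
  pairs-≤-power (suc (suc j)) m (s≤s j≤m) =
    ≤-trans (*-monoʳ-≤ (suc (suc j)) (<-^ (suc (suc j)) j (s≤s (s≤s z≤n))))
            (ℕₚ.^-monoʳ-≤ (suc (suc j)) j≤m)

  -- Metric invariants of a finite set S of integers used to separate affine
  -- classes: an upper bound D on its diameter, a distance L realised by two
  -- of its members, and a bound K on the distance of some two distinct members.
  DiameterAtMost : List ℤ → ℕ → Set
  DiameterAtMost S D = ∀ {u v} → u ∈ S → v ∈ S → ∣ u - v ∣ ≤ D

  HasSpan : List ℤ → ℕ → Set
  HasSpan S L = ∃[ u ] ∃[ v ] (u ∈ S × v ∈ S × ∣ u - v ∣ ≡ L)

  HasClosePair : List ℤ → ℕ → Set
  HasClosePair S K = ∃[ u ] ∃[ v ] (u ∈ S × v ∈ S × u ≢ v × ∣ u - v ∣ ≤ K)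

  AffEquiv-sym : ∀ {S T} → AffEquiv S T → AffEquiv T S
  AffEquiv-sym (x , r , r≢0 , inj₁ S≈rT) = x , r , r≢0 , inj₂ S≈rT
  AffEquiv-sym (x , r , r≢0 , inj₂ T≈rS) = x , r , r≢0 , inj₁ T≈rS

  affine-distance : ∀ x r u v → ∣ (x + r * u) - (x + r * v) ∣ ≡ ∣ r ∣ *ℕ ∣ u - v ∣
  affine-distance x r u v = trans (cong ∣_∣ (factor x r u v)) (abs-* r (u - v))
    where
    factor : ∀ x r u v → (x + r * u) - (x + r * v) ≡ r * (u - v)
    factor = solve-∀

  image : ∀ {S T x r u} → S ≈ₛ affImage x r T → u ∈ T → x + r * u ∈ S
  image S≈rT u∈ = Equivalence.from (S≈rT _) (∈-map⁺ _ u∈)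

  preimage : ∀ {S T x r c} → T ≈ₛ affImage x r S → c ∈ T → ∃[ s ] (s ∈ S × c ≡ x + r * s)
  preimage T≈rS c∈ = ∈-map⁻ _ (Equivalence.to (T≈rS _) c∈)

  -- If S = x + r·T, distances of T reappear scaled by |r| ≥ 1
  -- inside S; if T = x + r·S, the close pair of T forces |r| ≤ K, and L is |r|
  -- times a distance in S.
  affEquiv-bound : ∀ {S T D L K} → AffEquiv S T → DiameterAtMost S D
                 → HasSpan T L → HasClosePair T K → L ≤ K *ℕ D
  affEquiv-bound {D = D} {K = K} (x , r , r≢0 , inj₁ S≈rT) diam (u , v , u∈ , v∈ , refl)
                 (c , c' , _ , _ , c≢c' , close) =
    begin
      ∣ u - v ∣                               ≤⟨ ≤-scaled ∣ u - v ∣ (nonzero-abs r≢0) ⟩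
      ∣ r ∣ *ℕ ∣ u - v ∣                      ≡⟨ sym (affine-distance x r u v) ⟩
      ∣ (x + r * u) - (x + r * v) ∣           ≤⟨ diam (image {x = x} {r} S≈rT u∈) (image {x = x} {r} S≈rT v∈) ⟩
      D                                       ≤⟨ ≤-scaled D (≤-trans (distinct-distance c≢c') close) ⟩
      K *ℕ D                                  ∎
    where open ℕₚ.≤-Reasoning
  affEquiv-bound {D = D} {K = K} (x , r , r≢0 , inj₂ T≈rS) diam (u , v , u∈ , v∈ , refl)
                 (c , c' , c∈ , c'∈ , c≢c' , close)
    with preimage {x = x} {r} T≈rS c∈ | preimage {x = x} {r} T≈rS c'∈
       | preimage {x = x} {r} T≈rS u∈ | preimage {x = x} {r} T≈rS v∈
  ... | s , s∈ , refl | s' , s'∈ , refl | w , w∈ , refl | w' , w'∈ , refl =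
    begin
      ∣ (x + r * w) - (x + r * w') ∣          ≡⟨ affine-distance x r w w' ⟩
      ∣ r ∣ *ℕ ∣ w - w' ∣                     ≤⟨ *-mono-≤ |r|≤K (diam w∈ w'∈) ⟩
      K *ℕ D                                  ∎
    where
    open ℕₚ.≤-Reasoning
    s≢s' : s ≢ s'
    s≢s' s≡s' = c≢c' (cong (λ z → x + r * z) s≡s')
    |r|≤K : ∣ r ∣ ≤ K
    |r|≤K = begin
      ∣ r ∣                                   ≤⟨ ≤-scaled ∣ r ∣ (distinct-distance s≢s') ⟩
      ∣ s - s' ∣ *ℕ ∣ r ∣                      ≡⟨ ℕₚ.*-comm ∣ s - s' ∣ ∣ r ∣ ⟩
      ∣ r ∣ *ℕ ∣ s - s' ∣                      ≡⟨ sym (affine-distance x r s s') ⟩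
      ∣ (x + r * s) - (x + r * s') ∣          ≤⟨ close ⟩
      K                                       ∎

  module Construction (A : List ℤ) (a₀ : ℤ) (a₀∈A : a₀ ∈ A) (p t : ℕ)
                      (t-large : width A +ℕ width A < t) where

    q : ℕ
    q = suc p

    W : ℕ
    W = width A

    T : ℤ
    T = + t

    X : List ℤ
    X = deduplicate _≟_ A

    X-small : ∀ {x} → x ∈ X → ∣ x ∣ ≤ W
    X-small x∈ = elem-bound (∈-deduplicate⁻ _≟_ A x∈)

    shift : ℤ → List ℤ → List ℤ
    shift m L = map (λ y → y + T * m) L

    -- y = u + t·m with a small digit u; the choice of t makes the level m of
    -- such an integer unique.
    OnLevel : ℤ → ℤ → Set
    OnLevel m y = ∃[ u ] (∣ u ∣ ≤ W × y ≡ u + T * m)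

    -- Digits of size at most W are recovered from u + t·m, since 2W < t.
    digits-injective : ∀ {u v m m'} → ∣ u ∣ ≤ W → ∣ v ∣ ≤ W → u + T * m ≡ v + T * m' → m ≡ m' × u ≡ v
    digits-injective {u} {v} u-small v-small =
      block-injective t (≤-<-trans (≤-trans (∣i-j∣≤∣i∣+∣j∣ v u) (+-mono-≤ v-small u-small)) t-large)

    level-unique : ∀ {m m' y} → OnLevel m y → OnLevel m' y → m ≡ m'
    level-unique (u , u-small , refl) (v , v-small , e) = proj₁ (digits-injective {u} {v} u-small v-small e)

    shift-unique : ∀ {m L} → Unique L → Unique (shift m L)
    shift-unique {m} = map⁺ (+-cancelʳ (T * m))

    shift-level : ∀ {m L} → (∀ {y} → y ∈ L → ∣ y ∣ ≤ W) → ∀ {y} → y ∈ shift m L → OnLevel m y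
    shift-level {m} L-small y∈ with ∈-map⁻ (λ y → y + T * m) y∈
    ... | u , u∈ , refl = u , L-small u∈ , refl

    layered-unique : (f : ℕ → List ℤ) (n : ℕ) (g : List ℤ)
      → (∀ j → Unique (f j)) → (∀ j {y} → y ∈ f j → OnLevel (+ j) y)
      → Unique g → (∀ {y} → y ∈ g → OnLevel (+ n) y)
      → Unique (concatMap f (upTo n) ++ g)
    layered-unique f n g f-unique f-level g-unique g-level =
      ++⁺ (concatMap-unique f (upTo⁺ n) f-unique same-level) g-unique below-top
      where
      same-level : ∀ {i j y} → y ∈ f i → y ∈ f j → i ≡ j
      same-level y∈fi y∈fj = +-injective (level-unique (f-level _ y∈fi) (f-level _ y∈fj))
      below-top : ∀ {y} → ¬ (y ∈ concatMap f (upTo n) × y ∈ g)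
      below-top (y∈ , y∈g) with find (∈-concatMap⁻ f y∈)
      ... | j , j∈ , y∈fj =
        <-irrefl (+-injective (level-unique (f-level j y∈fj) (g-level y∈g))) (∈-upTo⁻ j∈)

    point-difference : ∀ x x' J J' → (x + T * J) - (x' + T * J') ≡ (x - x') + T * (J - J')
    point-difference x x' J J' = regroup x x' T J J'
      where
      regroup : ∀ x x' T J J' → (x + T * J) - (x' + T * J') ≡ (x - x') + T * (J - J')
      regroup = solve-∀

    point-sum : ∀ a b i j → (a + T * + i) + (b + T * + j) ≡ (a + b) + T * + (i +ℕ j)
    point-sum a b i j = trans (regroup a b T (+ i) (+ j)) (cong (λ z → (a + b) + T * z) (sym (pos-+ i j)))
      where
      regroup : ∀ a b T I J → (a + T * I) + (b + T * J) ≡ (a + b) + T * (I + J)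
      regroup = solve-∀

    blocks : List ℤ
    blocks = concatMap (λ j → shift (+ j) X) (upTo q)

    S : List ℤ
    S = blocks ++ shift (+ q) [ a₀ ]

    S⁻ : ∀ {y} → y ∈ S → ∃[ x ] ∃[ j ] (x ∈ A × j ≤ q × y ≡ x + T * + j)
    S⁻ y∈ with ∈-++⁻ blocks y∈
    ... | inj₂ (here refl) = a₀ , q , a₀∈A , ≤-refl , refl
    ... | inj₁ y∈blocks with find (∈-concatMap⁻ (λ j → shift (+ j) X) y∈blocks)
    ... | j , j∈ , y∈shift with ∈-map⁻ (λ y → y + T * + j) y∈shift
    ... | x , x∈ , refl = x , j , ∈-deduplicate⁻ _≟_ A x∈ , ℕₚ.<⇒≤ (∈-upTo⁻ j∈) , refl

    S⁺ : ∀ {x j} → x ∈ A → j < q → x + T * + j ∈ S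
    S⁺ {x} {j} x∈ j<q = ∈-++⁺ˡ (∈-concatMap⁺ (λ j → shift (+ j) X)
      (lose (∈-upTo⁺ j<q) (∈-map⁺ (λ y → y + T * + j) (∈-deduplicate⁺ _≟_ x∈))))

    top∈S : a₀ + T * + q ∈ S
    top∈S = ∈-++⁺ʳ blocks (here refl)

    S-unique : Unique S
    S-unique = layered-unique (λ j → shift (+ j) X) q (shift (+ q) [ a₀ ])
      (λ _ → shift-unique (deduplicate-! _≟_ A)) (λ _ → shift-level X-small)
      (shift-unique {+ q} {[ a₀ ]} (All.[] ∷ [])) (shift-level {+ q} {[ a₀ ]} λ { (here refl) → elem-bound a₀∈A })

    card-S : card S ≡ q *ℕ card A +ℕ 1
    card-S = begin
      card S                         ≡⟨ card-unique S-unique ⟩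
      length S                       ≡⟨ length-++ blocks ⟩
      length blocks +ℕ 1             ≡⟨ cong (_+ℕ 1) length-blocks ⟩
      length (upTo q) *ℕ card A +ℕ 1 ≡⟨ cong (λ z → z *ℕ card A +ℕ 1) (length-upTo q) ⟩
      q *ℕ card A +ℕ 1               ∎
      where
      open ≡-Reasoning
      length-blocks : length blocks ≡ length (upTo q) *ℕ card A
      length-blocks = length-concatMap (λ j → shift (+ j) X) (card A) (upTo q)
                                       (λ j → length-map (λ y → y + T * + j) X)

    D : List ℤ
    D = deduplicate _≟_ (diffSet A)

    differences : List ℤ
    differences = concatMap (λ m → shift m D) (symRange q)

    diffSet-S⊆ : diffSet S ⊆ differences
    diffSet-S⊆ y∈ with diffSet⁻ {S} y∈
    ... | u , v , u∈ , v∈ , refl with S⁻ u∈ | S⁻ v∈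
    ... | x , j , x∈ , j≤q , refl | x' , j' , x'∈ , j'≤q , refl =
      subst (_∈ differences) (sym (point-difference x x' (+ j) (+ j')))
        (∈-concatMap⁺ (λ m → shift m D) (lose (∈-symRange q (distance-≤ j≤q j'≤q))
          (∈-map⁺ (λ y → y + T * (+ j - + j')) (∈-deduplicate⁺ _≟_ (diffSet⁺ x∈ x'∈)))))

    card-diffSet-S : card (diffSet S) ≤ (suc q +ℕ q) *ℕ card (diffSet A)
    card-diffSet-S = ≤-trans (card-≤ {diffSet S} diffSet-S⊆) (ℕₚ.≤-reflexive length-differences)
      where
      length-differences : length differences ≡ (suc q +ℕ q) *ℕ card (diffSet A)
      length-differences =
        trans (length-concatMap (λ m → shift m D) (card (diffSet A)) (symRange q) (λ m → length-map (λ y → y + T * m) D))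
              (cong (_*ℕ card (diffSet A)) (length-symRange q))

    R : List ℤ
    R = deduplicate _≟_ (restrSumSet A)

    R-small : ∀ {ρ} → ρ ∈ R → ∣ ρ ∣ ≤ W
    R-small ρ∈ with restrSumSet⁻ {A} (∈-deduplicate⁻ _≟_ (restrSumSet A) ρ∈)
    ... | a , b , a∈ , b∈ , _ , refl = sum-bound a∈ b∈

    a₀+X : List ℤ
    a₀+X = map (λ x → a₀ + x) X

    sums : List ℤ
    sums = concatMap (λ m → shift (+ m) R) (upTo (q +ℕ p)) ++ shift (+ (q +ℕ p)) a₀+X

    sums-unique : Unique sums
    sums-unique = layered-unique (λ m → shift (+ m) R) (q +ℕ p) (shift (+ (q +ℕ p)) a₀+X)
      (λ _ → shift-unique (deduplicate-! _≟_ (restrSumSet A))) (λ _ → shift-level R-small)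
      (shift-unique (map⁺ (+-cancelˡ a₀) (deduplicate-! _≟_ A))) (shift-level a₀+X-small)
      where
      a₀+X-small : ∀ {y} → y ∈ a₀+X → ∣ y ∣ ≤ W
      a₀+X-small y∈ with ∈-map⁻ (λ x → a₀ + x) y∈
      ... | x , x∈ , refl = sum-bound a₀∈A (∈-deduplicate⁻ _≟_ A x∈)

    length-sums : length sums ≡ (q +ℕ p) *ℕ card (restrSumSet A) +ℕ card A
    length-sums = trans (length-++ (concatMap (λ m → shift (+ m) R) (upTo (q +ℕ p))))
      (cong₂ _+ℕ_
        (trans (length-concatMap (λ m → shift (+ m) R) (card (restrSumSet A)) (upTo (q +ℕ p))
                                 (λ m → length-map (λ y → y + T * + m) R))
               (cong (_*ℕ card (restrSumSet A)) (length-upTo (q +ℕ p))))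
        (trans (length-map (λ y → y + T * + (q +ℕ p)) a₀+X) (length-map (λ x → a₀ + x) X)))

    split : ∀ {m} → m < q +ℕ p → ∃[ i ] ∃[ j ] (i < q × j < q × i +ℕ j ≡ m)
    split {m} m<q+p with m ℕ.≤? p
    ... | yes m≤p = m , 0 , s≤s m≤p , s≤s z≤n , ℕₚ.+-identityʳ m
    ... | no  m≰p = p , m ∸ p , ≤-refl , ℕₚ.+-cancelʳ-< p (m ∸ p) q m-p+p<q+p , ℕₚ.m+[n∸m]≡n p≤m
      where
      p≤m : p ≤ m
      p≤m = ℕₚ.<⇒≤ (ℕₚ.≰⇒> m≰p)
      m-p+p<q+p : m ∸ p +ℕ p < q +ℕ p
      m-p+p<q+p = subst (_< q +ℕ p) (sym (ℕₚ.m∸n+n≡m p≤m)) m<q+p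

    sums⊆ : sums ⊆ restrSumSet S
    sums⊆ y∈ with ∈-++⁻ (concatMap (λ m → shift (+ m) R) (upTo (q +ℕ p))) y∈
    ... | inj₁ y∈low with find (∈-concatMap⁻ (λ m → shift (+ m) R) y∈low)
    ... | m , m∈ , y∈shift with ∈-map⁻ (λ y → y + T * + m) y∈shift | split (∈-upTo⁻ m∈)
    ... | ρ , ρ∈ , refl | i , j , i<q , j<q , refl
        with restrSumSet⁻ {A} (∈-deduplicate⁻ _≟_ (restrSumSet A) ρ∈)
    ... | a , b , a∈ , b∈ , a≢b , refl =
      subst (_∈ restrSumSet S) (point-sum a b i j)
        (restrSumSet⁺ (S⁺ a∈ i<q) (S⁺ b∈ j<q)
          (λ e → a≢b (proj₂ (digits-injective {a} {b} (elem-bound a∈) (elem-bound b∈) e))))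
    sums⊆ y∈ | inj₂ y∈top with ∈-map⁻ (λ y → y + T * + (q +ℕ p)) y∈top
    ... | _ , x∈' , refl with ∈-map⁻ (λ x → a₀ + x) x∈'
    ... | x , x∈ , refl =
      subst (_∈ restrSumSet S) (point-sum a₀ x q p)
        (restrSumSet⁺ top∈S (S⁺ x∈A ≤-refl) top≢x)
      where
      x∈A : x ∈ A
      x∈A = ∈-deduplicate⁻ _≟_ A x∈
      -- the two summands lie on the distinct levels q and p
      top≢x : a₀ + T * + q ≢ x + T * + p
      top≢x e = <-irrefl (sym (+-injective q≡p)) ≤-refl
        where
        q≡p : + q ≡ + p
        q≡p = proj₁ (digits-injective {a₀} {x} (elem-bound a₀∈A) (elem-bound x∈A) e)

    rsd-S : RSD A → card (restrSumSet A) ≤ q → RSD S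
    rsd-S rsdA small = begin-strict
      card (diffSet S)                                   ≤⟨ card-diffSet-S ⟩
      (suc q +ℕ q) *ℕ card (diffSet A)                   <⟨ rsd-inequality p _ _ (card A) rsdA small ⟩
      (q +ℕ p) *ℕ card (restrSumSet A) +ℕ card A         ≡⟨ sym length-sums ⟩
      length sums                                        ≤⟨ card-≥ sums-unique sums⊆ ⟩
      card (restrSumSet S)                               ∎
      where open ℕₚ.≤-Reasoning

    diameter-S : DiameterAtMost S (W +ℕ t *ℕ q)
    diameter-S u∈ v∈ with S⁻ u∈ | S⁻ v∈
    ... | x , j , x∈ , j≤q , refl | x' , j' , x'∈ , j'≤q , refl = begin
      ∣ (x + T * + j) - (x' + T * + j') ∣  ≡⟨ cong ∣_∣ (point-difference x x' (+ j) (+ j')) ⟩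
      ∣ (x - x') + T * (+ j - + j') ∣      ≤⟨ ∣i+j∣≤∣i∣+∣j∣ (x - x') _ ⟩
      ∣ x - x' ∣ +ℕ ∣ T * (+ j - + j') ∣   ≡⟨ cong (∣ x - x' ∣ +ℕ_) (abs-* T (+ j - + j')) ⟩
      ∣ x - x' ∣ +ℕ t *ℕ ∣ + j - + j' ∣    ≤⟨ +-mono-≤ (diff-bound x∈ x'∈) (*-monoʳ-≤ t (distance-≤ j≤q j'≤q)) ⟩
      W +ℕ t *ℕ q                          ∎
      where open ℕₚ.≤-Reasoning

    span-S : HasSpan S (t *ℕ q)
    span-S = a₀ + T * + q , a₀ + T * + 0 , top∈S , S⁺ a₀∈A (s≤s z≤n)
           , trans (affine-distance a₀ T (+ q) (+ 0)) (cong (t *ℕ_) (ℕₚ.+-identityʳ q))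

    close-S : ∀ {b₀} → b₀ ∈ A → a₀ ≢ b₀ → HasClosePair S W
    close-S {b₀} b₀∈A a₀≢b₀ =
      a₀ + T * + 0 , b₀ + T * + 0 , S⁺ a₀∈A (s≤s z≤n) , S⁺ b₀∈A (s≤s z≤n)
      , (λ e → a₀≢b₀ (+-cancelʳ (T * + 0) e))
      , subst (_≤ W) (sym (cong ∣_∣ (cancel a₀ b₀ (T * + 0)))) (diff-bound a₀∈A b₀∈A)
      where
      cancel : ∀ a b c → (a + c) - (b + c) ≡ a - b
      cancel = solve-∀

  -- Scales t₀ < t₁ < … with t₀ > 2K and t_j > K·(K + t_i·q) for i < j, so
  -- that the span t_j·q of S_{t_j} beats K times the diameter of S_{t_i}.
  module Scales (K q : ℕ) where

    scale : ℕ → ℕ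
    scale zero    = suc (K +ℕ K)
    scale (suc i) = scale i +ℕ suc (K *ℕ (K +ℕ scale i *ℕ q))

    scale-large : ∀ i → K +ℕ K < scale i
    scale-large zero    = ≤-refl
    scale-large (suc i) = <-≤-trans (scale-large i) (m≤m+n (scale i) _)

    scale-separated : ∀ {i j} → i < j → K *ℕ (K +ℕ scale i *ℕ q) < scale j
    scale-separated {i} {suc j} (s≤s i≤j) with ℕₚ.m≤n⇒m<n∨m≡n i≤j
    ... | inj₁ i<j  = <-≤-trans (scale-separated i<j) (m≤m+n (scale j) _)
    ... | inj₂ refl = m≤n+m (suc (K *ℕ (K +ℕ scale i *ℕ q))) (scale i)

  H*-infinite : ∀ A → RSD A → ∀ q → 0 < q → card (restrSumSet A) ≤ q → HStarInfinite (q *ℕ card A +ℕ 1)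
  H*-infinite A rsdA (suc p) _ small with distinct-pair {A} (≤-<-trans z≤n rsdA)
  ... | a₀ , b₀ , a₀∈A , b₀∈A , a₀≢b₀ = F , (λ i → Copy.card-S i , Copy.rsd-S i rsdA small) , inequivalent
    where
    open Scales (width A) (suc p)
    module Copy (i : ℕ) = Construction A a₀ a₀∈A p (scale i) (scale-large i)

    F : ℕ → List ℤ
    F i = Copy.S i

    -- For i < j the span of F j exceeds width A times the diameter of F i.
    increasing : ∀ {i j} → i < j → ¬ AffEquiv (F i) (F j)
    increasing {i} {j} i<j e = <-irrefl refl (<-≤-trans
      (<-≤-trans (scale-separated i<j) (ℕₚ.m≤m*n (scale j) (suc p)))
      (affEquiv-bound e (Copy.diameter-S i) (Copy.span-S j) (Copy.close-S j b₀∈A a₀≢b₀)))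

    inequivalent : ∀ i j → i ≢ j → ¬ AffEquiv (F i) (F j)
    inequivalent i j i≢j with ℕₚ.<-cmp i j
    ... | tri< i<j _ _ = increasing i<j
    ... | tri≈ _ i≡j _ = ⊥-elim (i≢j i≡j)
    ... | tri> _ _ j<i = λ e → increasing j<i (AffEquiv-sym e)

open Development using (H*-infinite; card-restrSumSet; pairs-≤-power)

open import Data.Nat using (ℕ; _≤_; _^_; _+_; NonZero)
open import Data.List using (List)
open import Data.Integer using (ℤ)
open import Data.Product using (∃; _×_)
open import Relation.Binary.PropositionalEquality using (_≡_)
open import Data.Nat using (zero; suc; >-nonZero⁻¹)
open import Data.Nat.Properties using (≤-trans; <-irrefl; *-comm; m^n>0)
open import Data.Product using (_,_)
open import Data.Empty using (⊥-elim)
open import Relation.Binary.PropositionalEquality using (refl; cong; subst)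

-- n = 0 is excluded by 1 ≤ k ≤ n.  For n = m + 1 apply H*-infinite with
-- q = k^m, using |A ∔ A| ≤ k(k - 1) ≤ k^m and k^m·k = k^n.
theorem1 : (k : ℕ) → NonZero k →
    (∃ λ (A : List ℤ) → card A ≡ k × RSD A) →
    (n : ℕ) → k ≤ n → HStarInfinite (k ^ n + 1)
theorem1 k k≢0 _ zero k≤0 = ⊥-elim (<-irrefl refl (≤-trans (>-nonZero⁻¹ k {{k≢0}}) k≤0))
theorem1 k k≢0 (A , refl , rsdA) (suc m) k≤n =
  subst HStarInfinite (cong (_+ 1) (*-comm (k ^ m) k)) (H*-infinite A rsdA (k ^ m) (m^n>0 k {{k≢0}} m) few-sums)
  where
  few-sums : card (restrSumSet A) ≤ k ^ m
  few-sums = ≤-trans (card-restrSumSet A) (pairs-≤-power k m k≤n)
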